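{- Let $v\geq 7$ and let $C_v$ be the configuration with point set $\mathbb{Z}_v$ and blocks $\{i,i+1,i+3\}$ for $i\in\mathbb{Z}_v$. Then the strong chromatic number of $C_v$ is \[\chi_s(C_v)=\begin{cases}7 & \text{if } v=7,\\ 6 & \text{if } v=11,\\ 5 & \text{if } v\equiv 1,2,3\pmod 4 \text{ and } v\notin\{7,11\},\\ 4 & \text{if } v\equiv 0\pmod 4.\end{cases}\]
   Context: A strong colouring of a configuration is an assignment of colours to points such that the three points of every block receive three distinct colours; the strong chromatic number $\chi_s$ is the minimum number of colours in a strong colouring. -}

module Defs where

open import Data.Nat using (ℕ; zero; suc; _+_; _%_; _≡ᵇ_; NonZero)
open import Data.Nat.DivMod using (_mod_)
open import Data.Fin using (Fin; toℕ)
open import Data.Product using (Σ; _×_)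
open import Relation.Binary.PropositionalEquality using (_≡_; _≢_)
open import Relation.Nullary using (¬_)
open import Data.Empty using (⊥)

_⊕_ : ∀ {v} .{{_ : NonZero v}} → Fin v → ℕ → Fin v
_⊕_ {v} i k = (toℕ i + k) mod v

Distinct3 : ∀ {A : Set} → A → A → A → Set
Distinct3 a b c = (a ≢ b) × (a ≢ c) × (b ≢ c)

IsStrongColouring : (v k : ℕ) .{{_ : NonZero v}} → (Fin v → Fin k) → Set
IsStrongColouring v k c = ∀ (i : Fin v) → Distinct3 (c i) (c (i ⊕ 1)) (c (i ⊕ 3))

StronglyColourable : (v k : ℕ) .{{_ : NonZero v}} → Set
StronglyColourable v k = Σ (Fin v → Fin k) (IsStrongColouring v k)

StrongChromaticNumber′ : (v k : ℕ) .{{_ : NonZero v}} → Set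
StrongChromaticNumber′ v k =
  StronglyColourable v k × (∀ (m : ℕ) → m Data.Nat.< k → ¬ StronglyColourable v m)

-- Version for an arbitrary v (C_0 is not meaningful; the theorem only uses v ≥ 7).
StrongChromaticNumber : (v k : ℕ) → Set
StrongChromaticNumber zero k = ⊥
StrongChromaticNumber (suc n) k = StrongChromaticNumber′ (suc n) k

-- Lift a strong colouring c of C_v to the v-periodic sequence C x = c (x mod v). The block at x
-- separates x from x + 1 and x + 3, and the block at x - 1 separates x from x + 2, so any four
-- consecutive terms of C are distinct. Hence at least four colours are needed; with exactly four
-- colours C also has period 4, so 4 divides v. For v = 7 all seven points are pairwise within
-- distance 3, and for v = 11 a colour class has at most two points, so five colours cover at most
-- ten points. Conversely, cyclic words with distinct windows of four letters that start with the
-- same three letters can be concatenated; abcd and abcde thus give every length 4i + 5j, which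
-- covers all v ≥ 8 except 11, and two explicit words handle v = 7 and v = 11.

module Submission where

open import Defs
open import Data.Empty using (⊥; ⊥-elim)
open import Data.Fin as Fin using (Fin; toℕ; combine)
open import Data.Fin.Patterns using (0F; 1F; 2F; 3F; 4F; 5F; 6F)
open import Data.Fin.Properties
  using (_≟_; _<?_; all?; any?; pigeonhole; combine-injective; toℕ<n; toℕ-fromℕ<; fromℕ<-cong)
open import Data.List using (List; []; _∷_; _++_; take; length)
open import Data.List.Properties using (++-assoc; length-++; take-take)
open import Data.List.Relation.Unary.All as All using (All; _∷_)
open import Data.Nat using (ℕ; zero; suc; _+_; _*_; _∸_; _≤_; _<_; _%_; _/_; z≤n; s≤s; NonZero)
import Data.Nat.Properties as ℕ
open import Data.Nat.DivMod using (_mod_; m%n<n; m≡m%n+[m/n]*n; [m+n]%n≡m%n; %-distribˡ-+; m%n%n≡m%n; %-remove-+ˡ; m<n⇒m%n≡m)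
open import Data.Nat.Divisibility using (∣-refl)
open import Data.Product using (∃; _×_; _,_; proj₁; proj₂)
open import Data.Sum using (_⊎_; inj₁; inj₂; [_,_])
open import Data.Unit using (⊤; tt)
open import Function using (_∘_)
open import Relation.Binary.Definitions using (DecidableEquality)
open import Relation.Binary.PropositionalEquality hiding ([_])
open import Relation.Nullary using (Dec; yes; no; ¬_; ¬?)
open import Relation.Nullary.Decidable using (True; False; toWitness; toWitnessFalse; _×-dec_; _⊎-dec_; _→-dec_)
open import Relation.Unary using (Decidable)

Near : ℕ → ℕ → Set
Near x y = y ≡ x + 1 ⊎ y ≡ x + 2 ⊎ y ≡ x + 3

near? : ∀ x y → Dec (Near x y)
near? x y = (y ℕ.≟ x + 1) ⊎-dec (y ℕ.≟ x + 2) ⊎-dec (y ℕ.≟ x + 3)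

near-+ : ∀ z {x y} → Near x y → Near (z + x) (z + y)
near-+ z {x} (inj₁ refl)        = inj₁ (sym (ℕ.+-assoc z x 1))
near-+ z {x} (inj₂ (inj₁ refl)) = inj₂ (inj₁ (sym (ℕ.+-assoc z x 2)))
near-+ z {x} (inj₂ (inj₂ refl)) = inj₂ (inj₂ (sym (ℕ.+-assoc z x 3)))

CyclicallyNear : ℕ → ℕ → ℕ → Set
CyclicallyNear v x y = Near x y ⊎ Near y (x + v)

cyclicallyNear? : ∀ v x y → Dec (CyclicallyNear v x y)
cyclicallyNear? v x y = near? x y ⊎-dec near? y (x + v)

[m%d+n]%d≡[m+n]%d : ∀ m n d .{{_ : NonZero d}} → (m % d + n) % d ≡ (m + n) % d
[m%d+n]%d≡[m+n]%d m n d = begin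
  (m % d + n) % d          ≡⟨ %-distribˡ-+ (m % d) n d ⟩
  (m % d % d + n % d) % d  ≡⟨ cong (λ t → (t + n % d) % d) (m%n%n≡m%n m d) ⟩
  (m % d + n % d) % d      ≡⟨ %-distribˡ-+ m n d ⟨
  (m + n) % d              ∎
  where open ≡-Reasoning

four-five-decomposition : ∀ v → 8 ≤ v → v ≢ 11 → Near 0 (v % 4) →
                          ∃ λ i → ∃ λ j → v ≡ suc j * 5 + i * 4
four-five-decomposition v 8≤v v≢11 near = decompose (v % 4) (v / 4) near (m≡m%n+[m/n]*n v 4)
  where
  excluded : ∀ {w} → v ≡ w → False (8 ℕ.≤? w) → ⊥
  excluded eq w<8 = toWitnessFalse w<8 (subst (8 ≤_) eq 8≤v)

  decompose : ∀ r q → Near 0 r → v ≡ r + q * 4 → ∃ λ i → ∃ λ j → v ≡ suc j * 5 + i * 4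
  decompose _ (suc i)             (inj₁ refl)        eq = i , 0 , eq
  decompose _ (suc (suc i))       (inj₂ (inj₁ refl)) eq = i , 1 , eq
  decompose _ (suc (suc (suc i))) (inj₂ (inj₂ refl)) eq = i , 2 , eq
  decompose _ 0       (inj₁ refl)        eq = ⊥-elim (excluded eq _)
  decompose _ 0       (inj₂ (inj₁ refl)) eq = ⊥-elim (excluded eq _)
  decompose _ 1       (inj₂ (inj₁ refl)) eq = ⊥-elim (excluded eq _)
  decompose _ 0       (inj₂ (inj₂ refl)) eq = ⊥-elim (excluded eq _)
  decompose _ 1       (inj₂ (inj₂ refl)) eq = ⊥-elim (excluded eq _)
  decompose _ 2       (inj₂ (inj₂ refl)) eq = ⊥-elim (v≢11 eq)

multiple-of-four : ∀ v → 1 ≤ v → v % 4 ≡ 0 → ∃ λ i → v ≡ suc i * 4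
multiple-of-four v 1≤v v%4≡0 with v / 4 | trans (m≡m%n+[m/n]*n v 4) (cong (_+ v / 4 * 4) v%4≡0)
... | zero  | v≡0 = ⊥-elim (ℕ.<⇒≢ 1≤v (sym v≡0))
... | suc i | eq  = i , eq

module _ {A : Set} where

  Spread : List A → Set
  Spread []       = ⊤
  Spread (x ∷ xs) = All (x ≢_) (take 3 xs) × Spread xs

  spread? : DecidableEquality A → Decidable Spread
  spread? _≟ᴬ_ []       = yes tt
  spread? _≟ᴬ_ (x ∷ xs) = All.all? (λ y → ¬? (x ≟ᴬ y)) (take 3 xs) ×-dec spread? _≟ᴬ_ xs

  take-++-take : ∀ {n m} → n ≤ m → ∀ (xs ys : List A) → take n (xs ++ take m ys) ≡ take n (xs ++ ys)
  take-++-take {zero}          _         _        _  = refl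
  take-++-take {suc n} {m}     n<m       []       ys =
    trans (take-take (suc n) m ys) (cong (λ l → take l ys) (ℕ.m≤n⇒m⊓n≡m n<m))
  take-++-take {suc n} {suc m} (s≤s n≤m) (x ∷ xs) ys = cong (x ∷_) (take-++-take (ℕ.m≤n⇒m≤1+n n≤m) xs ys)

  spread-++ : ∀ xs {ys : List A} → Spread (xs ++ take 3 ys) → Spread ys → Spread (xs ++ ys)
  spread-++ []            _            spread-ys = spread-ys
  spread-++ (x ∷ xs) {ys} (x≢ , spread) spread-ys =
    subst (All (x ≢_)) (take-++-take ℕ.≤-refl xs ys) x≢ , spread-++ xs spread spread-ys

-- A cyclic word is stored as the letters s after a fixed prefix a b c; its unrolling
-- a b c s a b c contains every cyclic window of four letters.
module CyclicWords {k} (a b c : Fin k) where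

  _!_ : List (Fin k) → ℕ → Fin k
  []       ! _     = a
  (x ∷ xs) ! zero  = x
  (x ∷ xs) ! suc i = xs ! i

  !-++ˡ : ∀ xs {ys i} → i < length xs → (xs ++ ys) ! i ≡ xs ! i
  !-++ˡ (x ∷ xs) {i = zero}  _         = refl
  !-++ˡ (x ∷ xs) {i = suc i} (s≤s i<n) = !-++ˡ xs i<n

  !-++ʳ : ∀ xs {ys} j → (xs ++ ys) ! (length xs + j) ≡ ys ! j
  !-++ʳ []       j = refl
  !-++ʳ (x ∷ xs) j = !-++ʳ xs j

  spread-! : ∀ {u} x {d} → Spread u → Near 0 d → x + d < length u → u ! x ≢ u ! (x + d)
  spread-! {_ ∷ _ ∷ _}         zero (p ∷ _ , _)         (inj₁ refl)        _ = p
  spread-! {_ ∷ _ ∷ _ ∷ _}     zero (_ ∷ p ∷ _ , _)     (inj₂ (inj₁ refl)) _ = p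
  spread-! {_ ∷ _ ∷ _ ∷ _ ∷ _} zero (_ ∷ _ ∷ p ∷ _ , _) (inj₂ (inj₂ refl)) _ = p
  spread-! {_ ∷ _}             (suc x) (_ , spread) d (s≤s bound) = spread-! x spread d bound
  spread-! {_ ∷ []}         zero _ (inj₁ refl)        (s≤s ())
  spread-! {_ ∷ []}         zero _ (inj₂ (inj₁ refl)) (s≤s ())
  spread-! {_ ∷ _ ∷ []}     zero _ (inj₂ (inj₁ refl)) (s≤s (s≤s ()))
  spread-! {_ ∷ []}         zero _ (inj₂ (inj₂ refl)) (s≤s ())
  spread-! {_ ∷ _ ∷ []}     zero _ (inj₂ (inj₂ refl)) (s≤s (s≤s ()))
  spread-! {_ ∷ _ ∷ _ ∷ []} zero _ (inj₂ (inj₂ refl)) (s≤s (s≤s (s≤s ())))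

  prefix : List (Fin k)
  prefix = a ∷ b ∷ c ∷ []

  CyclicallySpread : List (Fin k) → Set
  CyclicallySpread s = Spread (a ∷ b ∷ c ∷ s ++ prefix)

  cyclicallySpread-++ : ∀ {s t} → CyclicallySpread s → CyclicallySpread t →
                        CyclicallySpread (s ++ a ∷ b ∷ c ∷ t)
  cyclicallySpread-++ {s} {t} spread-s spread-t =
    subst Spread (cong (λ l → a ∷ b ∷ c ∷ l) (sym (++-assoc s (a ∷ b ∷ c ∷ t) prefix)))
      (spread-++ (a ∷ b ∷ c ∷ s) spread-s spread-t)

  Realisable : ℕ → Set
  Realisable v = ∃ λ s → CyclicallySpread s × 3 + length s ≡ v

  realisable-by-decision : ∀ s → True (spread? _≟_ (a ∷ b ∷ c ∷ s ++ prefix)) → Realisable (3 + length s)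
  realisable-by-decision s spread = s , toWitness spread , refl

  realisable-+ : ∀ {u v} → Realisable u → Realisable v → Realisable (u + v)
  realisable-+ (s , spread-s , refl) (t , spread-t , refl) =
    s ++ a ∷ b ∷ c ∷ t , cyclicallySpread-++ spread-s spread-t , cong (3 +_) (length-++ s)

  realisable-+* : ∀ {u v} → Realisable v → Realisable u → ∀ i → Realisable (v + i * u)
  realisable-+* rv ru zero    = subst Realisable (sym (ℕ.+-identityʳ _)) rv
  realisable-+* {u} {v} rv ru (suc i) =
    subst Realisable (trans (ℕ.+-assoc v (i * u) u) (cong (v +_) (ℕ.+-comm (i * u) u)))
      (realisable-+ (realisable-+* rv ru i) ru)

  !-unroll : ∀ s n → let w = a ∷ b ∷ c ∷ s in n < length w + 3 → w ! (n % length w) ≡ (w ++ prefix) ! n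
  !-unroll s n n<v+3 with n ℕ.<? length (a ∷ b ∷ c ∷ s)
  ... | yes n<v = trans (cong (w !_) (m<n⇒m%n≡m n<v)) (sym (!-++ˡ w n<v))
    where w = a ∷ b ∷ c ∷ s
  ... | no  n≮v = begin
    w ! (n % v)              ≡⟨ cong (λ m → w ! (m % v)) v+j≡n ⟨
    w ! ((v + j) % v)        ≡⟨ cong (w !_) (trans (%-remove-+ˡ j (∣-refl {v})) (m<n⇒m%n≡m j<v)) ⟩
    w ! j                    ≡⟨ !-++ˡ prefix j<3 ⟩
    prefix ! j               ≡⟨ !-++ʳ w j ⟨
    (w ++ prefix) ! (v + j)  ≡⟨ cong ((w ++ prefix) !_) v+j≡n ⟩
    (w ++ prefix) ! n        ∎
    where
    open ≡-Reasoning
    w = a ∷ b ∷ c ∷ s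
    v = length w
    j = n ∸ v
    v+j≡n : v + j ≡ n
    v+j≡n = ℕ.m+[n∸m]≡n (ℕ.≮⇒≥ n≮v)
    j<3 : j < 3
    j<3 = ℕ.+-cancelˡ-< v j 3 (subst (_< v + 3) (sym v+j≡n) n<v+3)
    j<v : j < v
    j<v = ℕ.<-≤-trans j<3 (ℕ.m≤m+n 3 (length s))

  colouring : ∀ {v} .{{_ : NonZero v}} → Realisable v → StronglyColourable v k
  colouring (s , spread , refl) = (λ i → w ! toℕ i) , distinct
    where
    w = a ∷ b ∷ c ∷ s
    u = w ++ prefix

    distinct : ∀ i → Distinct3 (w ! toℕ i) (w ! toℕ (i ⊕ 1)) (w ! toℕ (i ⊕ 3))
    distinct i =
        subst₂ _≢_ at-x (at-x+ 1 1≤3) (spread-! x spread (inj₁ refl) (in-range 1≤3))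
      , subst₂ _≢_ at-x (at-x+ 3 ℕ.≤-refl) (spread-! x spread (inj₂ (inj₂ refl)) (in-range ℕ.≤-refl))
      , subst₂ _≢_ (at-x+ 1 1≤3) (trans (cong (u !_) x+1+2≡x+3) (at-x+ 3 ℕ.≤-refl))
          (spread-! (x + 1) spread (inj₂ (inj₁ refl)) (subst (_< length u) (sym x+1+2≡x+3) (in-range ℕ.≤-refl)))
      where
      x = toℕ i
      1≤3 : 1 ≤ 3
      1≤3 = s≤s z≤n
      x+1+2≡x+3 : x + 1 + 2 ≡ x + 3
      x+1+2≡x+3 = ℕ.+-assoc x 1 2
      x+d<v+3 : ∀ {d} → d ≤ 3 → x + d < length w + 3
      x+d<v+3 = ℕ.+-mono-<-≤ (toℕ<n i)
      in-range : ∀ {d} → d ≤ 3 → x + d < length u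
      in-range {d} d≤3 = subst (x + d <_) (sym (length-++ w)) (x+d<v+3 d≤3)
      at-x : u ! x ≡ w ! x
      at-x = !-++ˡ w (toℕ<n i)
      at-x+ : ∀ d → d ≤ 3 → u ! (x + d) ≡ w ! toℕ (i ⊕ d)
      at-x+ d d≤3 = sym (trans (cong (w !_) (toℕ-fromℕ< (m%n<n (x + d) (length w)))) (!-unroll s (x + d) (x+d<v+3 d≤3)))

-- Pigeonhole on the colour paired with a flag recording whether that colour occurred earlier.
triple-pigeonhole : ∀ {m n} → m * 2 < n → (f : Fin n → Fin m) →
                    ∃ λ i → ∃ λ j → ∃ λ l → i Fin.< j × j Fin.< l × f i ≡ f j × f j ≡ f l
triple-pigeonhole {m} {n} 2m<n f =
  let i , j , i<j , eq = pigeonhole 2m<n (λ x → combine (f x) (flag (recurs? x)))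
      fi≡fj , same-flag = combine-injective (f i) _ (f j) _ eq
  in triple i<j fi≡fj (recurs? i) (recurs? j) same-flag
  where
  Recurs : Fin n → Set
  Recurs x = ∃ λ y → y Fin.< x × f y ≡ f x

  recurs? : ∀ x → Dec (Recurs x)
  recurs? x = any? λ y → (y <? x) ×-dec (f y ≟ f x)

  flag : ∀ {x} → Dec (Recurs x) → Fin 2
  flag (yes _) = 1F
  flag (no _)  = 0F

  triple : ∀ {i j} → i Fin.< j → f i ≡ f j → (ri : Dec (Recurs i)) (rj : Dec (Recurs j)) → flag ri ≡ flag rj →
           ∃ λ i → ∃ λ j → ∃ λ l → i Fin.< j × j Fin.< l × f i ≡ f j × f j ≡ f l
  triple i<j fi≡fj (yes (z , z<i , fz≡fi)) _         _  = z , _ , _ , z<i , i<j , fz≡fi , fi≡fj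
  triple i<j fi≡fj (no _)                  (no ¬rj) _  = ⊥-elim (¬rj (_ , i<j , fi≡fj))

module Lifted {n k} {c : Fin (suc n) → Fin k} (strong : IsStrongColouring (suc n) k c) where

  C : ℕ → Fin k
  C x = c (x mod suc n)

  C-% : ∀ x y → x % suc n ≡ y % suc n → C x ≡ C y
  C-% x y eq = cong c (fromℕ<-cong _ _ eq (m%n<n x (suc n)) (m%n<n y (suc n)))

  C-periodic : ∀ x → C (x + suc n) ≡ C x
  C-periodic x = C-% (x + suc n) x ([m+n]%n≡m%n x (suc n))

  C-⊕ : ∀ x d → c ((x mod suc n) ⊕ d) ≡ C (x + d)
  C-⊕ x d = C-% (toℕ (x mod suc n) + d) (x + d) (trans (cong (λ t → (t + d) % suc n) (toℕ-fromℕ< (m%n<n x (suc n))))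
                       ([m%d+n]%d≡[m+n]%d x d (suc n)))

  C-spread₁ : ∀ x → C x ≢ C (x + 1)
  C-spread₁ x = subst (C x ≢_) (C-⊕ x 1) (proj₁ (strong (x mod suc n)))

  C-spread₃ : ∀ x → C x ≢ C (x + 3)
  C-spread₃ x = subst (C x ≢_) (C-⊕ x 3) (proj₁ (proj₂ (strong (x mod suc n))))

  C-spread₂ : ∀ x → C x ≢ C (x + 2)
  C-spread₂ x = subst₂ _≢_ (trans (C-⊕ y 1) (shifted x+n+1≡x+v)) (trans (C-⊕ y 3) (shifted x+n+3≡x+2+v))
                  (proj₂ (proj₂ (strong (y mod suc n))))
    where
    y = x + n
    shifted : ∀ {z w} → z ≡ w + suc n → C z ≡ C w
    shifted {w = w} eq = trans (cong C eq) (C-periodic w)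
    x+n+1≡x+v : x + n + 1 ≡ x + suc n
    x+n+1≡x+v = trans (ℕ.+-assoc x n 1) (cong (x +_) (ℕ.+-comm n 1))
    x+n+3≡x+2+v : x + n + 3 ≡ x + 2 + suc n
    x+n+3≡x+2+v = trans (ℕ.+-assoc x n 3) (trans (cong (x +_) (ℕ.+-comm n 3)) (sym (ℕ.+-assoc x 2 (suc n))))

  C-near : ∀ {x y} → Near x y → C x ≢ C y
  C-near {x} (inj₁ refl)        = C-spread₁ x
  C-near {x} (inj₂ (inj₁ refl)) = C-spread₂ x
  C-near {x} (inj₂ (inj₂ refl)) = C-spread₃ x

  C-cyclicallyNear : ∀ {x y} → CyclicallyNear (suc n) x y → C x ≢ C y
  C-cyclicallyNear         (inj₁ near) = C-near near
  C-cyclicallyNear {x} {y} (inj₂ near) eq = C-near near (trans (sym eq) (sym (C-periodic x)))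

  pairwise-near⇒≤ : ∀ {N} (p : Fin N → ℕ) → (∀ i j → i Fin.< j → CyclicallyNear (suc n) (p i) (p j)) → N ≤ k
  pairwise-near⇒≤ p near = ℕ.≮⇒≥ λ k<N →
    let i , j , i<j , eq = pigeonhole k<N (C ∘ p) in C-cyclicallyNear (near i j i<j) eq

module FourColouring {n} {c : Fin (suc n) → Fin 4} (strong : IsStrongColouring (suc n) 4 c) where
  open Lifted strong

  near-or-ends : ∀ (i j : Fin 5) → i Fin.< j → Near (toℕ i) (toℕ j) ⊎ (i ≡ 0F × j ≡ 4F)
  near-or-ends = toWitness {a? = all? λ i → all? λ j → (i <? j) →-dec (near? (toℕ i) (toℕ j) ⊎-dec ((i ≟ 0F) ×-dec (j ≟ 4F)))} _

  C-period-4 : ∀ x → C (x + 4) ≡ C x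
  C-period-4 x with i , j , i<j , eq ← pigeonhole (ℕ.n<1+n 4) (λ i → C (x + toℕ i))
                  with near-or-ends i j i<j
  ... | inj₁ near           = ⊥-elim (C-near (near-+ x near) eq)
  ... | inj₂ (refl , refl)  = sym (trans (cong C (sym (ℕ.+-identityʳ x))) eq)

  C-period-4* : ∀ x q → C (x + q * 4) ≡ C x
  C-period-4* x zero    = cong C (ℕ.+-identityʳ x)
  C-period-4* x (suc q) = trans (cong C (sym (ℕ.+-assoc x 4 (q * 4)))) (trans (C-period-4* (x + 4) q) (C-period-4 x))

  4∣v : ¬ Near 0 (suc n % 4)
  4∣v near = C-near {0} near (begin
    C 0                               ≡⟨ C-periodic 0 ⟨
    C (suc n)                         ≡⟨ cong C (m≡m%n+[m/n]*n (suc n) 4) ⟩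
    C (suc n % 4 + suc n / 4 * 4)     ≡⟨ C-period-4* (suc n % 4) (suc n / 4) ⟩
    C (suc n % 4)                     ∎)
    where open ≡-Reasoning

fewer-colours-impossible : ∀ {n k} → (∀ {m} → StronglyColourable (suc n) m → k ≤ m) →
                           ∀ m → m < k → ¬ StronglyColourable (suc n) m
fewer-colours-impossible bound m m<k colourable = ℕ.<⇒≱ m<k (bound colourable)

χ≥4 : ∀ {n k} → StronglyColourable (suc n) k → 4 ≤ k
χ≥4 (_ , strong) = pairwise-near⇒≤ toℕ λ i j i<j → inj₁ (near-in-4 i j i<j)
  where
  open Lifted strong
  near-in-4 : ∀ (i j : Fin 4) → i Fin.< j → Near (toℕ i) (toℕ j)
  near-in-4 = toWitness {a? = all? λ i → all? λ j → (i <? j) →-dec near? (toℕ i) (toℕ j)} _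

χ≥5 : ∀ {n k} → Near 0 (suc n % 4) → StronglyColourable (suc n) k → 5 ≤ k
χ≥5 near colourable@(_ , strong) = ℕ.≤∧≢⇒< (χ≥4 colourable) λ { refl → FourColouring.4∣v strong near }

χ≥7 : ∀ {k} → StronglyColourable 7 k → 7 ≤ k
χ≥7 (_ , strong) = pairwise-near⇒≤ toℕ near-in-7
  where
  open Lifted strong
  near-in-7 : ∀ (i j : Fin 7) → i Fin.< j → CyclicallyNear 7 (toℕ i) (toℕ j)
  near-in-7 = toWitness {a? = all? λ i → all? λ j → (i <? j) →-dec cyclicallyNear? 7 (toℕ i) (toℕ j)} _

-- Three points of ℤ₁₁ pairwise at distance at least 4 would need 12 points.
¬5-colourable-11 : ¬ StronglyColourable 11 5
¬5-colourable-11 (_ , strong) =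
  let i , j , l , i<j , j<l , ci≡cj , cj≡cl = triple-pigeonhole (ℕ.n<1+n 10) (C ∘ toℕ)
  in [ (λ near → C-cyclicallyNear near ci≡cj)
     , [ (λ near → C-cyclicallyNear near cj≡cl) , (λ near → C-cyclicallyNear near (trans ci≡cj cj≡cl)) ] ]
     (near-pair i j l i<j j<l)
  where
  open Lifted strong
  near-pair : ∀ (i j l : Fin 11) → i Fin.< j → j Fin.< l →
              CyclicallyNear 11 (toℕ i) (toℕ j) ⊎ CyclicallyNear 11 (toℕ j) (toℕ l) ⊎ CyclicallyNear 11 (toℕ i) (toℕ l)
  near-pair = toWitness {a? = all? λ i → all? λ j → all? λ l → (i <? j) →-dec ((j <? l) →-dec
                (cyclicallyNear? 11 (toℕ i) (toℕ j) ⊎-dec cyclicallyNear? 11 (toℕ j) (toℕ l)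
                 ⊎-dec cyclicallyNear? 11 (toℕ i) (toℕ l)))} _

χ₁₁≥6 : ∀ {k} → StronglyColourable 11 k → 6 ≤ k
χ₁₁≥6 colourable = ℕ.≤∧≢⇒< (χ≥5 (inj₂ (inj₂ refl)) colourable) λ { refl → ¬5-colourable-11 colourable }

7-colourable-7 : StronglyColourable 7 7
7-colourable-7 = colouring (realisable-by-decision (3F ∷ 4F ∷ 5F ∷ 6F ∷ []) _)
  where open CyclicWords {7} 0F 1F 2F

6-colourable-11 : StronglyColourable 11 6
6-colourable-11 = colouring (realisable-by-decision (3F ∷ 4F ∷ 0F ∷ 1F ∷ 2F ∷ 3F ∷ 4F ∷ 5F ∷ []) _)
  where open CyclicWords {6} 0F 1F 2F

4-colourable : ∀ v .{{_ : NonZero v}} → v % 4 ≡ 0 → StronglyColourable v 4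
4-colourable v@(suc _) v%4≡0 with multiple-of-four v (s≤s z≤n) v%4≡0
... | i , refl = colouring (realisable-+* abcd abcd i)
  where
  open CyclicWords {4} 0F 1F 2F
  abcd = realisable-by-decision (3F ∷ []) _

5-colourable : ∀ v .{{_ : NonZero v}} → 8 ≤ v → v ≢ 11 → Near 0 (v % 4) → StronglyColourable v 5
5-colourable v 8≤v v≢11 near with four-five-decomposition v 8≤v v≢11 near
... | i , j , refl = colouring (realisable-+* (realisable-+* abcde abcde j) abcd i)
  where
  open CyclicWords {5} 0F 1F 2F
  abcd = realisable-by-decision (3F ∷ []) _
  abcde = realisable-by-decision (3F ∷ 4F ∷ []) _

theorem21 : (v : ℕ) → 7 ≤ v →
    (v ≡ 7 → StrongChromaticNumber v 7)
    × (v ≡ 11 → StrongChromaticNumber v 6)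
    × ((v % 4 ≡ 1 ⊎ v % 4 ≡ 2 ⊎ v % 4 ≡ 3) → v ≢ 7 → v ≢ 11 →
         StrongChromaticNumber v 5)
    × (v % 4 ≡ 0 → StrongChromaticNumber v 4)
theorem21 (suc n) 7≤v =
    (λ { refl → 7-colourable-7 , fewer-colours-impossible χ≥7 })
  , (λ { refl → 6-colourable-11 , fewer-colours-impossible χ₁₁≥6 })
    -- The hypothesis v % 4 ≡ 1 ⊎ v % 4 ≡ 2 ⊎ v % 4 ≡ 3 is Near 0 (v % 4) by definition.
  , (λ near v≢7 v≢11 → 5-colourable (suc n) (ℕ.≤∧≢⇒< 7≤v (v≢7 ∘ sym)) v≢11 near
                     , fewer-colours-impossible (χ≥5 near))
  , (λ v%4≡0 → 4-colourable (suc n) v%4≡0 , fewer-colours-impossible χ≥4)
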